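{- Let $\mathcal{F}$ be a propositional formula, $\nu$ a satisfying assignment of $\mathcal{F}$, and $\mathcal{V}$ the set of literals true under $\nu$. Let $\mathcal{R}=\mathcal{V}$ and for $\mathcal{W}\subseteq\mathcal{R}$ let $P(\mathcal{W})=\neg\mathrm{SAT}\big(\mathcal{F}\wedge\bigvee_{l\in\mathcal{R}\setminus\mathcal{W}}\neg l\big)$. Then $P$ is monotone, and for every minimal subset $\mathcal{T}\subseteq\mathcal{R}$ for $P$, the set $\mathcal{V}\setminus\mathcal{T}$ is the backbone of $\mathcal{F}$ relative to $\mathcal{V}$, i.e. the (unique) maximal set $\mathcal{B}\subseteq\mathcal{V}$ with $\mathcal{F}\models\bigwedge_{l\in\mathcal{B}}l$. (Hence FBBr reduces to the MSMP problem.)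
   Context: An empty disjunction is false. $\mathrm{SAT}(\varphi)$ is $1$ iff $\varphi$ is satisfiable. A predicate $P:2^{\mathcal{R}}\to\{0,1\}$ is monotone if $P(\mathcal{R}_0)$ and $\mathcal{R}_0\subseteq\mathcal{R}_1\subseteq\mathcal{R}$ imply $P(\mathcal{R}_1)$; $\mathcal{M}\subseteq\mathcal{R}$ is minimal for $P$ if $P(\mathcal{M})$ holds and $P(\mathcal{M}')$ fails for every $\mathcal{M}'\subsetneq\mathcal{M}$. The MSMP problem asks for a minimal set for a given monotone predicate. -}

module Defs where

open import Level using (0ℓ)
open import Data.Nat using (ℕ)
open import Data.Fin using (Fin)
open import Data.Bool using (Bool; true; false; not; _∧_; _∨_)
open import Data.Product using (Σ; ∃; _×_; _,_)
open import Relation.Nullary using (¬_)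
open import Relation.Binary.PropositionalEquality using (_≡_)
open import Relation.Unary using (Pred; _∈_; _∉_; _⊆_; _∖_)

data Formula (n : ℕ) : Set where
  var  : Fin n → Formula n
  ⊤ᶠ   : Formula n
  ⊥ᶠ   : Formula n
  ¬ᶠ_  : Formula n → Formula n
  _∧ᶠ_ : Formula n → Formula n → Formula n
  _∨ᶠ_ : Formula n → Formula n → Formula n

Assignment : ℕ → Set
Assignment n = Fin n → Bool

⟦_⟧ : ∀ {n} → Formula n → Assignment n → Bool
⟦ var x ⟧   ν = ν x
⟦ ⊤ᶠ ⟧      ν = true
⟦ ⊥ᶠ ⟧      ν = false
⟦ ¬ᶠ φ ⟧    ν = not (⟦ φ ⟧ ν)
⟦ φ ∧ᶠ ψ ⟧  ν = ⟦ φ ⟧ ν ∧ ⟦ ψ ⟧ ν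
⟦ φ ∨ᶠ ψ ⟧  ν = ⟦ φ ⟧ ν ∨ ⟦ ψ ⟧ ν

_⊨ᵃ_ : ∀ {n} → Assignment n → Formula n → Set
ν ⊨ᵃ φ = ⟦ φ ⟧ ν ≡ true

data Literal (n : ℕ) : Set where
  pos : Fin n → Literal n
  neg : Fin n → Literal n

litVal : ∀ {n} → Assignment n → Literal n → Bool
litVal ν (pos x) = ν x
litVal ν (neg x) = not (ν x)

LitSet : ℕ → Set₁
LitSet n = Pred (Literal n) 0ℓ

trueLits : ∀ {n} → Assignment n → LitSet n
trueLits ν l = litVal ν l ≡ true

-- SAT ( F ∧ ⋁_{l ∈ S} ¬ l ):  some assignment satisfies F and falsifies
-- some literal of S.  (An empty disjunction is false.)
SAT-∧-⋁¬ : ∀ {n} → Formula n → LitSet n → Set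
SAT-∧-⋁¬ F S = ∃ λ σ → σ ⊨ᵃ F × ∃ λ l → l ∈ S × litVal σ l ≡ false

_⊨⋀_ : ∀ {n} → Formula n → LitSet n → Set
F ⊨⋀ B = ∀ σ → σ ⊨ᵃ F → ∀ l → l ∈ B → litVal σ l ≡ true

_⊊_ : ∀ {n} → LitSet n → LitSet n → Set
M' ⊊ M = M' ⊆ M × ∃ λ l → l ∈ M × l ∉ M'

Monotone : ∀ {n} → LitSet n → (LitSet n → Set) → Set₁
Monotone R P = ∀ (R₀ R₁ : LitSet _) → R₀ ⊆ R₁ → R₁ ⊆ R → P R₀ → P R₁

MinimalFor : ∀ {n} → LitSet n → (LitSet n → Set) → LitSet n → Set₁
MinimalFor R P M = M ⊆ R × P M × (∀ (M' : LitSet _) → M' ⊊ M → ¬ P M')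

IsBackboneRel : ∀ {n} → Formula n → LitSet n → LitSet n → Set₁
IsBackboneRel F V B =
  B ⊆ V × F ⊨⋀ B × (∀ (B' : LitSet _) → B' ⊆ V → F ⊨⋀ B' → B' ⊆ B)

redP : ∀ {n} → Formula n → LitSet n → LitSet n → Set
redP F R W = ¬ SAT-∧-⋁¬ F (R ∖ W)

-- P(W) says exactly that F entails every literal of R ∖ W.  Hence a minimal T
-- makes R ∖ T entailed, and if some l ∈ T were entailed as well, dropping l
-- from T would keep P true, contradicting minimality.

module Submission where

open import Defs
open import Data.Bool using (false)
open import Data.Bool.Properties using (¬-not; not-¬)
open import Data.Nat using (ℕ)
open import Data.Product using (_×_; _,_; proj₁; proj₂)
open import Relation.Binary.PropositionalEquality using (_≡_; refl)
open import Relation.Nullary using (¬_)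
open import Relation.Unary using (_∈_; _∖_; _⊆_; ｛_｝)

module _ {n : ℕ} (F : Formula n) (R : LitSet n) where

  redP-monotone : Monotone R (redP F R)
  redP-monotone R₀ R₁ R₀⊆R₁ _ P₀ (σ , σ⊨F , l , (l∈R , l∉R₁) , l-false) =
    P₀ (σ , σ⊨F , l , (l∈R , λ l∈R₀ → l∉R₁ (R₀⊆R₁ l∈R₀)) , l-false)

  redP⇒⊨⋀ : ∀ {W} → redP F R W → F ⊨⋀ (R ∖ W)
  redP⇒⊨⋀ P σ σ⊨F l l∈R∖W = ¬-not λ l-false → P (σ , σ⊨F , l , l∈R∖W , l-false)

  ⊨⋀⇒redP : ∀ {W} → F ⊨⋀ (R ∖ W) → redP F R W
  ⊨⋀⇒redP F⊨R∖W (σ , σ⊨F , l , l∈R∖W , l-false) =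
    not-¬ (F⊨R∖W σ σ⊨F l l∈R∖W) l-false

  ⊨⋀-∖-remove : ∀ {T B l} → F ⊨⋀ (R ∖ T) → F ⊨⋀ B → l ∈ B →
                F ⊨⋀ (R ∖ (T ∖ ｛ l ｝))
  ⊨⋀-∖-remove F⊨R∖T F⊨B l∈B σ σ⊨F x (x∈R , x∉T∖l) = ¬-not λ x-false →
    not-¬ (F⊨R∖T σ σ⊨F x (x∈R , λ x∈T → x∉T∖l (x∈T , x≢l x-false))) x-false
    where
    x≢l : litVal σ x ≡ false → ¬ (_ ≡ x)
    x≢l x-false refl = not-¬ (F⊨B σ σ⊨F _ l∈B) x-false

  minimal⇒backbone : ∀ T → MinimalFor R (redP F R) T → IsBackboneRel F R (R ∖ T)
  minimal⇒backbone T (_ , P-T , T-minimal) = proj₁ , F⊨R∖T , maximal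
    where
    F⊨R∖T : F ⊨⋀ (R ∖ T)
    F⊨R∖T = redP⇒⊨⋀ P-T

    maximal : ∀ B → B ⊆ R → F ⊨⋀ B → B ⊆ (R ∖ T)
    maximal B B⊆R F⊨B {l} l∈B = B⊆R l∈B , λ l∈T →
      T-minimal (T ∖ ｛ l ｝) (proj₁ , l , l∈T , λ l∈T∖l → proj₂ l∈T∖l refl)
        (⊨⋀⇒redP (⊨⋀-∖-remove F⊨R∖T F⊨B l∈B))

proposition21 : ∀ {n} (F : Formula n) (ν : Assignment n) → ν ⊨ᵃ F →
    Monotone (trueLits ν) (redP F (trueLits ν))
    × (∀ T → MinimalFor (trueLits ν) (redP F (trueLits ν)) T →
         IsBackboneRel F (trueLits ν) (trueLits ν ∖ T))
proposition21 F ν _ = redP-monotone F (trueLits ν) , minimal⇒backbone F (trueLits ν)
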